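{- Let $m,n\ge 1$ be natural numbers, let $T$ be a finite set with $|T|\ge 2$, and let $L$ be any set of conditions of the form $H^p_t$ and $V^q_t$ with $t\in T$ and $p,q\in\{2,3,4,\ldots\}\cup\{\infty\}$. Let $N=\lceil \frac{m}{2}\rceil \lceil\frac{n}{2}\rceil$. Then there exist at least $|T|^N$ tilings $f:G_{m,n}\to T$ which are $L$-dappled.
   Context: For natural numbers $m,n$, $G_{m,n}=\{(i,j)\in\mathbb{Z}\times\mathbb{Z}\mid 0\le i<m,\ 0\le j<n\}$ (its elements are called cells). A tiling of $G_{m,n}$ with $T$ is any function $f:G_{m,n}\to T$. For $p>1$ and $t\in T$, $f$ satisfies the condition $H^p_t$ if there is no $(i,j)\in G_{m,n}$ with $i\ge p$ and $f(i,j)=f(i-1,j)=\cdots=f(i-p,j)=t$ (no horizontal run of more than $p$ consecutive $t$'s); $f$ satisfies $V^q_t$ ($q>1$) if there is no $(i,j)\in G_{m,n}$ with $j\ge q$ and $f(i,j)=f(i,j-1)=\cdots=f(i,j-q)=t$. The conditions $H^\infty_t$ and $V^\infty_t$ are always satisfied. A tiling is $L$-dappled if it satisfies every condition in $L$. -}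

module Defs where

open import Data.Nat using (ℕ; _≤_; _+_; _*_; ⌈_/2⌉)
open import Data.Fin using (Fin; toℕ)
open import Data.Empty using (⊥)
open import Relation.Binary.PropositionalEquality using (_≡_)
open import Relation.Nullary using (¬_)

-- The tile set T is modelled as Fin k (any finite set of size k).
-- A tiling of G_{m,n} with T: cell (i , j), 0 ≤ i < m, 0 ≤ j < n.
Tiling : ℕ → ℕ → ℕ → Set
Tiling m n k = Fin m → Fin n → Fin k

data ⊤ : Set where
  tt : ⊤

data Exponent : Set where
  fin : ℕ → Exponent
  ∞   : Exponent

data Condition (k : ℕ) : Set where
  H : Exponent → Fin k → Condition k
  V : Exponent → Fin k → Condition k

WellFormedExp : Exponent → Set
WellFormedExp (fin p) = 2 ≤ p
WellFormedExp ∞       = ⊤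

WellFormed : ∀ {k} → Condition k → Set
WellFormed (H e _) = WellFormedExp e
WellFormed (V e _) = WellFormedExp e

-- H^p_t : no (i , j) with i ≥ p and f(i,j) = f(i-1,j) = ... = f(i-p,j) = t
SatH : ∀ {m n k} → ℕ → Fin k → Tiling m n k → Set
SatH {m} {n} p t f =
  ∀ (i : Fin m) (j : Fin n) → p ≤ toℕ i →
    ¬ (∀ (d : ℕ) → d ≤ p → ∀ (i′ : Fin m) → toℕ i′ + d ≡ toℕ i → f i′ j ≡ t)

-- V^q_t : no (i , j) with j ≥ q and f(i,j) = f(i,j-1) = ... = f(i,j-q) = t
SatV : ∀ {m n k} → ℕ → Fin k → Tiling m n k → Set
SatV {m} {n} q t f =
  ∀ (i : Fin m) (j : Fin n) → q ≤ toℕ j →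
    ¬ (∀ (d : ℕ) → d ≤ q → ∀ (j′ : Fin n) → toℕ j′ + d ≡ toℕ j → f i j′ ≡ t)

Satisfies : ∀ {m n k} → Tiling m n k → Condition k → Set
Satisfies f (H (fin p) t) = SatH p t f
Satisfies f (H ∞ t)       = ⊤
Satisfies f (V (fin q) t) = SatV q t f
Satisfies f (V ∞ t)       = ⊤

Dappled : ∀ {m n k} → (Condition k → Set) → Tiling m n k → Set
Dappled L f = ∀ c → L c → Satisfies f c

N : ℕ → ℕ → ℕ
N m n = ⌈ m /2⌉ * ⌈ n /2⌉

module Submission where

-- Cut the grid into ⌈m/2⌉ × ⌈n/2⌉ blocks of (at most)
-- 2 × 2 cells and choose a tile freely for every block; this gives
-- k ^ N m n choices, encoded by the digits of x : Fin (k ^ N m n).  The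
-- cell (i , j) of block (u , v) receives the chosen tile A u v, replaced by
-- a different tile when i + j is odd.  Two horizontally or vertically
-- adjacent cells of one block then have i + j of different parity and hence
-- different tiles.  Every window of three consecutive cells of a row or
-- column contains such a pair, so no row or column has a run of three equal
-- tiles, which violates no condition H^p_t or V^q_t with p, q ≥ 2.  The
-- cell (2u , 2v) carries A u v unchanged, so distinct choices give distinct
-- tilings.

open import Defs
open import Data.Nat using (ℕ; zero; suc; _+_; _*_; _^_; _≤_; z≤n; s≤s; s≤s⁻¹; ⌊_/2⌋; ⌈_/2⌉; parity)
open import Data.Nat.Properties using (+-comm; +-suc; +-identityʳ; <⇒≤; ≤-trans)
open import Data.Fin using (Fin; toℕ; inject₁; combine; remQuot; finToFun; funToFin)
  renaming (zero to fzero; suc to fsuc)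
open import Data.Fin.Properties using (toℕ-injective; toℕ-inject₁; combine-remQuot; funToFin-finToFin)
open import Data.Parity using (Parity; 0ℙ; 1ℙ) renaming (_+_ to _+ℙ_)
open import Data.Parity.Properties using (+-homo-+)
open import Data.Product using (Σ; Σ-syntax; _×_; _,_; proj₁; proj₂)
open import Data.Sum using (_⊎_; inj₁; inj₂) renaming (map to ⊎-map)
open import Data.Empty using (⊥)
open import Relation.Nullary using (¬_)
open import Relation.Binary.PropositionalEquality

NoRun : ∀ {m} {A : Set} → ℕ → A → (Fin m → A) → Set
NoRun {m} p t h =
  ∀ (i : Fin m) → p ≤ toℕ i →
    ¬ (∀ (d : ℕ) → d ≤ p → ∀ (i′ : Fin m) → toℕ i′ + d ≡ toℕ i → h i′ ≡ t)

BlockSeparated : ∀ {m} {A : Set} → (Fin m → A) → Set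
BlockSeparated {m} h =
  ∀ (a b : Fin m) → ⌊ toℕ a /2⌋ ≡ ⌊ toℕ b /2⌋ → suc (toℕ a) ≡ toℕ b → h a ≢ h b

pair-in-block : ∀ e → ⌊ e /2⌋ ≡ ⌊ suc e /2⌋ ⊎ ⌊ suc e /2⌋ ≡ ⌊ suc (suc e) /2⌋
pair-in-block zero = inj₁ refl
pair-in-block (suc zero) = inj₂ refl
pair-in-block (suc (suc e)) = ⊎-map (cong suc) (cong suc) (pair-in-block e)

no-three-in-a-row : ∀ {m} {A : Set} {h : Fin m → A} → BlockSeparated h →
  ∀ (a b c : Fin m) → suc (toℕ a) ≡ toℕ b → suc (toℕ b) ≡ toℕ c →
  h a ≡ h b → h b ≡ h c → ⊥
no-three-in-a-row sep a b c ab bc hab hbc with pair-in-block (toℕ a)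
... | inj₁ same = sep a b (trans same (cong ⌊_/2⌋ ab)) ab hab
... | inj₂ same = sep b c bc-same bc hbc
  where
  open ≡-Reasoning
  bc-same : ⌊ toℕ b /2⌋ ≡ ⌊ toℕ c /2⌋
  bc-same = begin
    ⌊ toℕ b /2⌋             ≡⟨ cong ⌊_/2⌋ (sym ab) ⟩
    ⌊ suc (toℕ a) /2⌋       ≡⟨ same ⟩
    ⌊ suc (suc (toℕ a)) /2⌋ ≡⟨ cong (λ s → ⌊ suc s /2⌋) ab ⟩
    ⌊ suc (toℕ b) /2⌋       ≡⟨ cong ⌊_/2⌋ bc ⟩
    ⌊ toℕ c /2⌋             ∎

predecessor : ∀ {m} (c : Fin m) → 1 ≤ toℕ c → Σ[ b ∈ Fin m ] suc (toℕ b) ≡ toℕ c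
predecessor (fsuc c) _ = inject₁ c , cong suc (toℕ-inject₁ c)

-- A run of length p + 1 ≥ 3 would contain three equal consecutive entries.
separated⇒no-run : ∀ {m} {A : Set} {h : Fin m → A} → BlockSeparated h →
  ∀ p (t : A) → 2 ≤ p → NoRun p t h
separated⇒no-run sep p t 2≤p i p≤i run =
  no-three-in-a-row sep a b i sa sb
    (trans (run 2 2≤p a a-at-2) (sym (run 1 1≤p b b-at-1)))
    (trans (run 1 1≤p b b-at-1) (sym (run 0 z≤n i (+-identityʳ (toℕ i)))))
  where
  -- the run covers positions i - 2 = a, i - 1 = b and i
  1≤p : 1 ≤ p
  1≤p = <⇒≤ 2≤p
  2≤i : 2 ≤ toℕ i
  2≤i = ≤-trans 2≤p p≤i
  b : Fin _
  b = proj₁ (predecessor i (<⇒≤ 2≤i))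
  sb : suc (toℕ b) ≡ toℕ i
  sb = proj₂ (predecessor i (<⇒≤ 2≤i))
  a : Fin _
  a = proj₁ (predecessor b (s≤s⁻¹ (subst (2 ≤_) (sym sb) 2≤i)))
  sa : suc (toℕ a) ≡ toℕ b
  sa = proj₂ (predecessor b (s≤s⁻¹ (subst (2 ≤_) (sym sb) 2≤i)))
  b-at-1 : toℕ b + 1 ≡ toℕ i
  b-at-1 = trans (+-comm (toℕ b) 1) sb
  a-at-2 : toℕ a + 2 ≡ toℕ i
  a-at-2 = trans (+-comm (toℕ a) 2) (trans (cong suc sa) sb)

half : ∀ {m} → Fin m → Fin ⌈ m /2⌉
half {suc m} fzero = fzero
half {suc (suc m)} (fsuc fzero) = fzero
half {suc (suc m)} (fsuc (fsuc i)) = fsuc (half i)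

toℕ-half : ∀ {m} (i : Fin m) → toℕ (half i) ≡ ⌊ toℕ i /2⌋
toℕ-half {suc m} fzero = refl
toℕ-half {suc (suc m)} (fsuc fzero) = refl
toℕ-half {suc (suc m)} (fsuc (fsuc i)) = cong suc (toℕ-half i)

same-half : ∀ {m} (a b : Fin m) → ⌊ toℕ a /2⌋ ≡ ⌊ toℕ b /2⌋ → half a ≡ half b
same-half a b eq = toℕ-injective (trans (toℕ-half a) (trans eq (sym (toℕ-half b))))

double : ∀ {m} → Fin ⌈ m /2⌉ → Fin m
double {suc zero} fzero = fzero
double {suc (suc m)} fzero = fzero
double {suc (suc m)} (fsuc u) = fsuc (fsuc (double u))

half-double : ∀ {m} (u : Fin ⌈ m /2⌉) → half {m} (double u) ≡ u
half-double {suc zero} fzero = refl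
half-double {suc (suc m)} fzero = refl
half-double {suc (suc m)} (fsuc u) = cong fsuc (half-double u)

parity-double : ∀ {m} (u : Fin ⌈ m /2⌉) → parity (toℕ (double {m} u)) ≡ 0ℙ
parity-double {suc zero} fzero = refl
parity-double {suc (suc m)} fzero = refl
parity-double {suc (suc m)} (fsuc u) = parity-double {m} u

funToFin-cong : ∀ {c k} {f g : Fin c → Fin k} → (∀ i → f i ≡ g i) → funToFin f ≡ funToFin g
funToFin-cong {zero} eq = refl
funToFin-cong {suc c} eq = cong₂ combine (eq fzero) (funToFin-cong (λ i → eq (fsuc i)))

finToFun-injective : ∀ {k c} (x y : Fin (k ^ c)) →
  (∀ i → finToFun x i ≡ finToFun y i) → x ≡ y
finToFun-injective {k} {c} x y eq = begin
  x                             ≡⟨ sym (funToFin-finToFin {c} {k} x) ⟩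
  funToFin (finToFun {k} {c} x) ≡⟨ funToFin-cong {c} {k} eq ⟩
  funToFin (finToFun {k} {c} y) ≡⟨ funToFin-finToFin {c} {k} y ⟩
  y                             ∎
  where open ≡-Reasoning

by-blocks : ∀ {a b} {P : Fin (a * b) → Set} → (∀ u v → P (combine u v)) → ∀ c → P c
by-blocks {a} {b} {P} h c =
  subst P (combine-remQuot {a} b c) (h (proj₁ (remQuot {a} b c)) (proj₂ (remQuot {a} b c)))

other : ∀ {k} → Fin (suc (suc k)) → Fin (suc (suc k))
other fzero = fsuc fzero
other (fsuc _) = fzero

-- other has no fixed point, which is all the construction needs of it.
other-≢ : ∀ {k} (v : Fin (suc (suc k))) → other v ≢ v
other-≢ fzero ()
other-≢ (fsuc _) ()

twist : ∀ {k} → Parity → Fin (suc (suc k)) → Fin (suc (suc k))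
twist 0ℙ v = v
twist 1ℙ v = other v

-- s and s + 1 have different parities, so they twist a tile differently.
twist-suc-≢ : ∀ {k} s (v : Fin (suc (suc k))) → twist (parity (suc s)) v ≢ twist (parity s) v
twist-suc-≢ zero v = other-≢ v
twist-suc-≢ (suc zero) v = λ eq → other-≢ v (sym eq)
twist-suc-≢ (suc (suc s)) v = twist-suc-≢ s v

chequered : ∀ {m n k} → (Fin ⌈ m /2⌉ → Fin ⌈ n /2⌉ → Fin (suc (suc k))) → Tiling m n (suc (suc k))
chequered A i j = twist (parity (toℕ i + toℕ j)) (A (half i) (half j))

module _ {m n k} (A : Fin ⌈ m /2⌉ → Fin ⌈ n /2⌉ → Fin (suc (suc k))) where

  -- Within a block, the two cells of a row differ in the parity of i + j.
  chequered-rows : ∀ j → BlockSeparated (λ i → chequered A i j)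
  chequered-rows j a b same ab eq = twist-suc-≢ (toℕ a + toℕ j) (A (half a) (half j)) (begin
    twist (parity (suc (toℕ a + toℕ j))) (A (half a) (half j))
      ≡⟨ cong₂ (λ s u → twist (parity (s + toℕ j)) (A u (half j))) ab (same-half a b same) ⟩
    twist (parity (toℕ b + toℕ j)) (A (half b) (half j))
      ≡⟨ sym eq ⟩
    twist (parity (toℕ a + toℕ j)) (A (half a) (half j)) ∎)
    where open ≡-Reasoning

  chequered-columns : ∀ i → BlockSeparated (λ j → chequered A i j)
  chequered-columns i a b same ab eq = twist-suc-≢ (toℕ i + toℕ a) (A (half i) (half a)) (begin
    twist (parity (suc (toℕ i + toℕ a))) (A (half i) (half a))
      ≡⟨ cong₂ (λ s u → twist (parity s) (A (half i) u))
           (trans (sym (+-suc (toℕ i) (toℕ a))) (cong (toℕ i +_) ab)) (same-half a b same) ⟩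
    twist (parity (toℕ i + toℕ b)) (A (half i) (half b))
      ≡⟨ sym eq ⟩
    twist (parity (toℕ i + toℕ a)) (A (half i) (half a)) ∎)
    where open ≡-Reasoning

  chequered-corner : ∀ u v → chequered A (double u) (double v) ≡ A u v
  chequered-corner u v = cong₂ twist corner-even (cong₂ A (half-double u) (half-double v))
    where
    open ≡-Reasoning
    corner-even : parity (toℕ (double {m} u) + toℕ (double {n} v)) ≡ 0ℙ
    corner-even = begin
      parity (toℕ (double {m} u) + toℕ (double {n} v))
        ≡⟨ +-homo-+ (toℕ (double {m} u)) (toℕ (double {n} v)) ⟩
      parity (toℕ (double {m} u)) +ℙ parity (toℕ (double {n} v))
        ≡⟨ cong₂ _+ℙ_ (parity-double {m} u) (parity-double {n} v) ⟩
      0ℙ ∎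

separated⇒dappled : ∀ {m n k} (f : Tiling m n k) →
  (∀ j → BlockSeparated (λ i → f i j)) → (∀ i → BlockSeparated (λ j → f i j)) →
  (L : Condition k → Set) → (∀ c → L c → WellFormed c) → Dappled L f
separated⇒dappled f rows columns L wf (H (fin p) t) lc i j = separated⇒no-run (rows j) p t (wf _ lc) i
separated⇒dappled f rows columns L wf (H ∞ t) lc = tt
separated⇒dappled f rows columns L wf (V (fin q) t) lc i j = separated⇒no-run (columns i) q t (wf _ lc) j
separated⇒dappled f rows columns L wf (V ∞ t) lc = tt

chequered-injective : ∀ {m n k} (A B : Fin ⌈ m /2⌉ → Fin ⌈ n /2⌉ → Fin (suc (suc k))) →
  (∀ i j → chequered A i j ≡ chequered B i j) → ∀ u v → A u v ≡ B u v
chequered-injective A B eq u v =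
  trans (sym (chequered-corner A u v)) (trans (eq (double u) (double v)) (chequered-corner B u v))

mainTheorem1 : (m n k : ℕ) → 1 ≤ m → 1 ≤ n → 2 ≤ k →
    (L : Condition k → Set) → (∀ c → L c → WellFormed c) →
    Σ (Fin (k ^ N m n) → Tiling m n k) λ g →
      (∀ x → Dappled L (g x)) ×
      (∀ x y → (∀ i j → g x i j ≡ g y i j) → x ≡ y)
mainTheorem1 m n (suc (suc k)) _ _ (s≤s (s≤s z≤n)) L wf = tiling , dappled , injective
  where
  blocks : Fin (suc (suc k) ^ N m n) → Fin ⌈ m /2⌉ → Fin ⌈ n /2⌉ → Fin (suc (suc k))
  blocks x u v = finToFun x (combine u v)
  tiling : Fin (suc (suc k) ^ N m n) → Tiling m n (suc (suc k))
  tiling x = chequered (blocks x)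
  dappled : ∀ x → Dappled L (tiling x)
  dappled x = separated⇒dappled (tiling x)
    (chequered-rows (blocks x)) (chequered-columns (blocks x)) L wf
  injective : ∀ x y → (∀ i j → tiling x i j ≡ tiling y i j) → x ≡ y
  injective x y eq = finToFun-injective {suc (suc k)} {N m n} x y
    (by-blocks {⌈ m /2⌉} {⌈ n /2⌉} {λ c → finToFun x c ≡ finToFun y c}
      (chequered-injective (blocks x) (blocks y) eq))
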